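{- Let $\{G_n\}$ be a generalized Fibonacci sequence. For all integers $n > 0$ and $m > 0$, \[ G_{nm} = G_n \sum_{i=0}^{\lfloor (m-1)/2 \rfloor} \binom{m-1-i}{i} L_n^{\,m-2i-1} (-1)^{i(n+1)} + G_0 \sum_{i=1}^{\lfloor m/2 \rfloor} \binom{m-1-i}{i-1} L_n^{\,m-2i} (-1)^{i(n+1)}. \]
   Context: A generalized Fibonacci sequence $\{G_n\}$ has arbitrary initial values $G_0, G_1$ and satisfies $G_n = G_{n-1} + G_{n-2}$ for $n \ge 2$. $\{L_n\}$ is the Lucas sequence, $L_0 = 2$, $L_1 = 1$, $L_n = L_{n-1} + L_{n-2}$ for $n \ge 2$. An empty sum equals $0$. -}

module Defs where

open import Data.Nat as ℕ using (ℕ; zero; suc)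
open import Data.Nat.Combinatorics using (_C_)
open import Data.Integer using (ℤ; +_; _+_; _*_; -_; _^_)

G : ℤ → ℤ → ℕ → ℤ
G a b zero = a
G a b (suc zero) = b
G a b (suc (suc n)) = G a b (suc n) + G a b n

L : ℕ → ℤ
L zero = + 2
L (suc zero) = + 1
L (suc (suc n)) = L (suc n) + L n

negOnePow : ℕ → ℤ
negOnePow k = (- (+ 1)) ^ k

-- Σ_{i = lo}^{hi} f i  (empty, i.e. 0, when hi < lo)
sumFromTo : ℕ → ℕ → (ℕ → ℤ) → ℤ
sumFromTo lo hi f = go (suc hi ℕ.∸ lo)
  where
  go : ℕ → ℤ
  go zero = + 0
  go (suc k) = go k + f (lo ℕ.+ k)

binom : ℕ → ℕ → ℤ
binom n k = + (n C k)

-- Put x = Lₙ and q = (-1)ⁿ⁺¹. The identity G(k + 2n) + (-1)ⁿ G(k) = Lₙ G(k + n) says that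
-- m ↦ G(nm) satisfies the second-order recurrence sₘ₊₂ = x sₘ₊₁ + q sₘ, so it is the
-- combination G(n) Uₘ + q G(0) Uₘ₋₁ of the Lucas sequence U = U(x, q) with U₀ = 0, U₁ = 1.
-- The two sums of the theorem are the classical binomial expansions of Uₘ and q Uₘ₋₁,
-- which follow from Pascal's rule.
module Submission where

open import Defs
open import Data.Nat as ℕ using (ℕ; zero; suc; _/_; _∸_; _>_; _<_; _≤_; z≤n; s≤s)
open import Data.Integer using (ℤ; +_; _+_; _*_; -_; _^_)
open import Data.Nat.Combinatorics using (_C_; nCk+nC[k+1]≡[n+1]C[k+1])
open import Data.Nat.Combinatorics.Specification using (k>n⇒nCk≡0)
import Data.Nat.Properties as ℕₚ
import Data.Nat.DivMod as ℕₚ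
import Data.Integer.Properties as ℤₚ
import Data.Integer.Tactic.RingSolver as ℤ-Solver
import Data.Nat.Tactic.RingSolver as ℕ-Solver
open import Relation.Nullary using (yes; no)
open import Function using (_∘_)
open import Relation.Binary.PropositionalEquality
open ≡-Reasoning

∑< : ℕ → (ℕ → ℤ) → ℤ
∑< zero    f = + 0
∑< (suc n) f = ∑< n f + f n

∑<-cong : ∀ n {f g : ℕ → ℤ} → (∀ k → f k ≡ g k) → ∑< n f ≡ ∑< n g
∑<-cong zero    f≡g = refl
∑<-cong (suc n) f≡g = cong₂ _+_ (∑<-cong n f≡g) (f≡g n)

∑<-+ : ∀ n f g → ∑< n (λ k → f k + g k) ≡ ∑< n f + ∑< n g
∑<-+ zero    f g = refl
∑<-+ (suc n) f g = trans (cong (_+ (f n + g n)) (∑<-+ n f g)) (interchange (∑< n f) (∑< n g) (f n) (g n))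
  where
  interchange : ∀ a b c d → a + b + (c + d) ≡ a + c + (b + d)
  interchange = ℤ-Solver.solve-∀

∑<-*ˡ : ∀ n c f → ∑< n (λ k → c * f k) ≡ c * ∑< n f
∑<-*ˡ zero    c f = sym (ℤₚ.*-zeroʳ c)
∑<-*ˡ (suc n) c f = trans (cong (_+ c * f n) (∑<-*ˡ n c f)) (sym (ℤₚ.*-distribˡ-+ c (∑< n f) (f n)))

∑<-head : ∀ n f → ∑< (suc n) f ≡ f 0 + ∑< n (λ k → f (suc k))
∑<-head zero    f = ℤₚ.+-comm (+ 0) (f 0)
∑<-head (suc n) f = trans (cong (_+ f (suc n)) (∑<-head n f)) (ℤₚ.+-assoc (f 0) _ _)

∑<-extend : ∀ {n m} f → n ≤ m → (∀ k → n ≤ k → f k ≡ + 0) → ∑< m f ≡ ∑< n f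
∑<-extend {n} f n≤m vanish = go (ℕₚ.≤⇒≤′ n≤m)
  where
  go : ∀ {m} → n ℕ.≤′ m → ∑< m f ≡ ∑< n f
  go ℕ.≤′-refl       = refl
  go (ℕ.≤′-step n≤m) =
    trans (cong₂ _+_ (go n≤m) (vanish _ (ℕₚ.≤′⇒≤ n≤m))) (ℤₚ.+-identityʳ _)

sumFromTo-0 : ∀ hi f → sumFromTo 0 hi f ≡ ∑< (suc hi) f
sumFromTo-0 zero     f = refl
sumFromTo-0 (suc hi) f = cong (_+ f (suc hi)) (sumFromTo-0 hi f)

sumFromTo-1 : ∀ hi f → sumFromTo 1 hi f ≡ ∑< hi (λ k → f (suc k))
sumFromTo-1 zero     f = refl
sumFromTo-1 (suc hi) f = cong (_+ f (suc hi)) (sumFromTo-1 hi f)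

-- Lucas sequence of the first kind, Uₘ₊₂ = x Uₘ₊₁ + q Uₘ (classically written U(P, Q) with x = P, q = -Q).
lucasU : ℤ → ℤ → ℕ → ℤ
lucasU x q zero          = + 0
lucasU x q (suc zero)    = + 1
lucasU x q (suc (suc m)) = x * lucasU x q (suc m) + q * lucasU x q m

Recurrent : ℤ → ℤ → (ℕ → ℤ) → Set
Recurrent x q s = ∀ m → s (suc (suc m)) ≡ x * s (suc m) + q * s m

recurrent⇒lucasU-combination : ∀ {x q} s → Recurrent x q s →
  ∀ m → s (suc m) ≡ s 1 * lucasU x q (suc m) + s 0 * (q * lucasU x q m)
recurrent⇒lucasU-combination {x} {q} s rec = go
  where
  U : ℕ → ℤ
  U = lucasU x q

  go : ∀ m → s (suc m) ≡ s 1 * U (suc m) + s 0 * (q * U m)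
  go zero = base₀ (s 1) (s 0) q
    where
    base₀ : ∀ s₁ s₀ q → s₁ ≡ s₁ * + 1 + s₀ * (q * + 0)
    base₀ = ℤ-Solver.solve-∀
  go (suc zero) = trans (rec 0) (base₁ x q (s 1) (s 0))
    where
    base₁ : ∀ x q s₁ s₀ → x * s₁ + q * s₀ ≡ s₁ * (x * + 1 + q * + 0) + s₀ * (q * + 1)
    base₁ = ℤ-Solver.solve-∀
  go (suc (suc m)) = begin
    s (3 ℕ.+ m)                                 ≡⟨ rec (suc m) ⟩
    x * s (2 ℕ.+ m) + q * s (suc m)             ≡⟨ cong₂ (λ u v → x * u + q * v) (go (suc m)) (go m) ⟩
    x * (s 1 * U (2 ℕ.+ m) + s 0 * (q * U (suc m))) + q * (s 1 * U (suc m) + s 0 * (q * U m))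
                                                ≡⟨ regroup x q (s 1) (s 0) (U (2 ℕ.+ m)) (U (suc m)) (U m) ⟩
    s 1 * U (3 ℕ.+ m) + s 0 * (q * U (2 ℕ.+ m)) ∎
    where
    regroup : ∀ x q s₁ s₀ u₂ u₁ u₀ →
      x * (s₁ * u₂ + s₀ * (q * u₁)) + q * (s₁ * u₁ + s₀ * (q * u₀))
        ≡ s₁ * (x * u₂ + q * u₁) + s₀ * (q * (x * u₁ + q * u₀))
    regroup = ℤ-Solver.solve-∀

-- The coefficient of yᵏ in (x + y)ᵈ; for k > d the junk exponent d ∸ k is harmless since the binomial is 0.
pascal : ℤ → ℕ → ℕ → ℤ
pascal x d k = binom d k * x ^ (d ∸ k)

pascal-≡0 : ∀ x {d k} → d < k → pascal x d k ≡ + 0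
pascal-≡0 x {d} {k} d<k = cong (λ c → + c * x ^ (d ∸ k)) (k>n⇒nCk≡0 d<k)

pascal-suc-suc : ∀ x d k → pascal x (suc d) (suc k) ≡ x * pascal x d (suc k) + pascal x d k
pascal-suc-suc x d k = begin
  + (suc d C suc k) * x ^ (d ∸ k)                   ≡⟨ cong (λ c → + c * x ^ (d ∸ k)) (sym (nCk+nC[k+1]≡[n+1]C[k+1] d k)) ⟩
  + (d C k ℕ.+ d C suc k) * x ^ (d ∸ k)             ≡⟨ cong (_* x ^ (d ∸ k)) (ℤₚ.pos-+ (d C k) (d C suc k)) ⟩
  (binom d k + binom d (suc k)) * x ^ (d ∸ k)       ≡⟨ ℤₚ.*-distribʳ-+ (x ^ (d ∸ k)) (binom d k) (binom d (suc k)) ⟩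
  pascal x d k + binom d (suc k) * x ^ (d ∸ k)      ≡⟨ cong (λ t → pascal x d k + t) shifted ⟩
  pascal x d k + x * pascal x d (suc k)             ≡⟨ ℤₚ.+-comm (pascal x d k) _ ⟩
  x * pascal x d (suc k) + pascal x d k             ∎
  where
  shifted : binom d (suc k) * x ^ (d ∸ k) ≡ x * pascal x d (suc k)
  shifted with k ℕ.<? d
  ... | yes k<d = trans (cong (λ e → binom d (suc k) * x ^ e) (ℕₚ.+-∸-assoc 1 k<d))
                        (swap (binom d (suc k)) x (x ^ (d ∸ suc k)))
    where
    swap : ∀ b x y → b * (x * y) ≡ x * (b * y)
    swap = ℤ-Solver.solve-∀
  ... | no k≮d  = begin
    binom d (suc k) * x ^ (d ∸ k)  ≡⟨ cong (λ c → + c * x ^ (d ∸ k)) (k>n⇒nCk≡0 d<1+k) ⟩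
    + 0                            ≡⟨ sym (ℤₚ.*-zeroʳ x) ⟩
    x * + 0                        ≡⟨ cong (x *_) (sym (pascal-≡0 x d<1+k)) ⟩
    x * pascal x d (suc k)         ∎
    where
    d<1+k : d < suc k
    d<1+k = s≤s (ℕₚ.≮⇒≥ k≮d)

pascal-∸ : ∀ x m j → pascal x (suc m ∸ j) (suc j) ≡ x * pascal x (m ∸ j) (suc j) + pascal x (m ∸ j) j
pascal-∸ x m j with j ℕ.≤? m
... | yes j≤m rewrite ℕₚ.+-∸-assoc 1 j≤m = pascal-suc-suc x (m ∸ j) j
... | no j≰m  = beyond (ℕₚ.≰⇒> j≰m)
  where
  beyond : m < j → pascal x (suc m ∸ j) (suc j) ≡ x * pascal x (m ∸ j) (suc j) + pascal x (m ∸ j) j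
  beyond m<j rewrite ℕₚ.m≤n⇒m∸n≡0 m<j | ℕₚ.m≤n⇒m∸n≡0 (ℕₚ.<⇒≤ m<j) = begin
    pascal x 0 (suc j)                      ≡⟨ pascal-≡0 x {0} {suc j} (s≤s z≤n) ⟩
    + 0                                     ≡⟨ sym (cong₂ _+_ (ℤₚ.*-zeroʳ x) (pascal-≡0 x (ℕₚ.<-≤-trans (s≤s z≤n) m<j))) ⟩
    x * + 0 + pascal x 0 j                  ≡⟨ cong (λ t → x * t + pascal x 0 j) (sym (pascal-≡0 x {0} {suc j} (s≤s z≤n))) ⟩
    x * pascal x 0 (suc j) + pascal x 0 j   ∎

-- Cₘ₋ᵢ,ᵢ xᵐ⁻²ⁱ qⁱ, the i-th term of the binomial expansion of Uₘ₊₁.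
binomialTerm : ℤ → ℤ → ℕ → ℕ → ℤ
binomialTerm x q m i = pascal x (m ∸ i) i * q ^ i

binomialTerm-≡0 : ∀ x q {m i} → m < i ℕ.+ i → binomialTerm x q m i ≡ + 0
binomialTerm-≡0 x q {m} {suc i} m<2i = cong (_* q ^ suc i) (pascal-≡0 x (ℕₚ.m<n+o⇒m∸n<o m (suc i) m<2i))

binomialTerm-zero : ∀ x q m → binomialTerm x q (suc m) 0 ≡ x * binomialTerm x q m 0
binomialTerm-zero x q m = shuffle x (x ^ m)
  where
  shuffle : ∀ x y → + 1 * (x * y) * + 1 ≡ x * (+ 1 * y * + 1)
  shuffle = ℤ-Solver.solve-∀

binomialTerm-suc : ∀ x q m j →
  binomialTerm x q (2 ℕ.+ m) (suc j) ≡ x * binomialTerm x q (suc m) (suc j) + q * binomialTerm x q m j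
binomialTerm-suc x q m j = begin
  pascal x (suc m ∸ j) (suc j) * (q * q ^ j)
    ≡⟨ cong (_* (q * q ^ j)) (pascal-∸ x m j) ⟩
  (x * pascal x (m ∸ j) (suc j) + pascal x (m ∸ j) j) * (q * q ^ j)
    ≡⟨ expand x q (pascal x (m ∸ j) (suc j)) (pascal x (m ∸ j) j) (q ^ j) ⟩
  x * (pascal x (m ∸ j) (suc j) * (q * q ^ j)) + q * (pascal x (m ∸ j) j * q ^ j) ∎
  where
  expand : ∀ x q a b e → (x * a + b) * (q * e) ≡ x * (a * (q * e)) + q * (b * e)
  expand = ℤ-Solver.solve-∀

∑<-binomialTerm-recurrent : ∀ x q m →
  ∑< (3 ℕ.+ m) (binomialTerm x q (2 ℕ.+ m))
    ≡ x * ∑< (2 ℕ.+ m) (binomialTerm x q (suc m)) + q * ∑< (suc m) (binomialTerm x q m)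
∑<-binomialTerm-recurrent x q m = begin
  ∑< (3 ℕ.+ m) t₂
    ≡⟨ ∑<-head (2 ℕ.+ m) t₂ ⟩
  t₂ 0 + ∑< (2 ℕ.+ m) (λ j → t₂ (suc j))
    ≡⟨ cong₂ _+_ (binomialTerm-zero x q (suc m)) (∑<-cong (2 ℕ.+ m) (binomialTerm-suc x q m)) ⟩
  x * t₁ 0 + ∑< (2 ℕ.+ m) (λ j → x * t₁ (suc j) + q * t₀ j)
    ≡⟨ cong (λ t → x * t₁ 0 + t) (trans (∑<-+ (2 ℕ.+ m) _ _) (cong₂ _+_ (∑<-*ˡ (2 ℕ.+ m) x _) (∑<-*ˡ (2 ℕ.+ m) q t₀))) ⟩
  x * t₁ 0 + (x * ∑< (2 ℕ.+ m) (λ j → t₁ (suc j)) + q * ∑< (2 ℕ.+ m) t₀)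
    ≡⟨ regroup x q (t₁ 0) _ _ ⟩
  x * (t₁ 0 + ∑< (2 ℕ.+ m) (λ j → t₁ (suc j))) + q * ∑< (2 ℕ.+ m) t₀
    ≡⟨ cong₂ (λ u v → x * u + q * v) (sym (∑<-head (2 ℕ.+ m) t₁)) (drop-last m) ⟩
  x * ∑< (3 ℕ.+ m) t₁ + q * ∑< (suc m) t₀
    ≡⟨ cong (λ u → x * u + q * ∑< (suc m) t₀) (drop-last (suc m)) ⟩
  x * ∑< (2 ℕ.+ m) t₁ + q * ∑< (suc m) t₀ ∎
  where
  t₀ t₁ t₂ : ℕ → ℤ
  t₀ = binomialTerm x q m
  t₁ = binomialTerm x q (suc m)
  t₂ = binomialTerm x q (2 ℕ.+ m)

  regroup : ∀ x q a b c → x * a + (x * b + q * c) ≡ x * (a + b) + q * c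
  regroup = ℤ-Solver.solve-∀

  drop-last : ∀ n → ∑< (2 ℕ.+ n) (binomialTerm x q n) ≡ ∑< (suc n) (binomialTerm x q n)
  drop-last n = ∑<-extend (binomialTerm x q n) (ℕₚ.n≤1+n (suc n))
    (λ k 1+n≤k → binomialTerm-≡0 x q {n} {k} (ℕₚ.<-≤-trans 1+n≤k (ℕₚ.m≤m+n k k)))

lucasU-binomial : ∀ x q m → lucasU x q (suc m) ≡ ∑< (suc m) (binomialTerm x q m)
lucasU-binomial x q zero          = refl
lucasU-binomial x q (suc zero)    = initial x q
  where
  initial : ∀ x q → x * + 1 + q * + 0 ≡ + 0 + + 1 * (x * + 1) * + 1 + + 0 * + 1 * (q * + 1)
  initial = ℤ-Solver.solve-∀
lucasU-binomial x q (suc (suc m)) = begin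
  x * lucasU x q (2 ℕ.+ m) + q * lucasU x q (suc m)
    ≡⟨ cong₂ (λ u v → x * u + q * v) (lucasU-binomial x q (suc m)) (lucasU-binomial x q m) ⟩
  x * ∑< (2 ℕ.+ m) (binomialTerm x q (suc m)) + q * ∑< (suc m) (binomialTerm x q m)
    ≡⟨ sym (∑<-binomialTerm-recurrent x q m) ⟩
  ∑< (3 ℕ.+ m) (binomialTerm x q (2 ℕ.+ m)) ∎

half<⇒<double : ∀ {m k} → m / 2 < k → m < k ℕ.+ k
half<⇒<double {m} {k} half<k = subst (m <_) (double k) (ℕₚ.<-≤-trans m<2[1+m/2] (ℕₚ.*-monoˡ-≤ 2 half<k))
  where
  m<2[1+m/2] : m < suc (m / 2) ℕ.* 2
  m<2[1+m/2] = subst (_< suc (m / 2) ℕ.* 2) (sym (ℕₚ.m≡m%n+[m/n]*n m 2))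
                     (ℕₚ.+-monoˡ-< (m / 2 ℕ.* 2) (ℕₚ.m%n<n m 2))
  double : ∀ k → k ℕ.* 2 ≡ k ℕ.+ k
  double = ℕ-Solver.solve-∀

lucasU-suc-binomial-half : ∀ x q m → lucasU x q (suc m) ≡ ∑< (suc (m / 2)) (binomialTerm x q m)
lucasU-suc-binomial-half x q m = trans (lucasU-binomial x q m)
  (∑<-extend (binomialTerm x q m) (s≤s (ℕₚ.m/n≤m m 2)) (λ k → binomialTerm-≡0 x q {m} {k} ∘ half<⇒<double))

lucasU-binomial-half : ∀ x q m → lucasU x q m ≡ ∑< (suc m / 2) (binomialTerm x q (m ∸ 1))
lucasU-binomial-half x q zero    = refl
lucasU-binomial-half x q (suc m) = trans (lucasU-suc-binomial-half x q m)
  (cong (λ n → ∑< n (binomialTerm x q m)) (sym (ℕₚ.m/n≡1+[m∸n]/n {2 ℕ.+ m} {2} (s≤s (s≤s z≤n)))))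

negOnePow-* : ∀ i k → negOnePow (i ℕ.* k) ≡ negOnePow k ^ i
negOnePow-* i k = trans (cong negOnePow (ℕₚ.*-comm i k)) (sym (ℤₚ.^-*-assoc (- + 1) k i))

lucasU≡sumFromTo₀ : ∀ x n m →
  lucasU x (negOnePow (n ℕ.+ 1)) (suc m)
    ≡ sumFromTo 0 (m / 2) (λ i → binom (m ∸ i) i * x ^ (suc m ∸ 2 ℕ.* i ∸ 1) * negOnePow (i ℕ.* (n ℕ.+ 1)))
lucasU≡sumFromTo₀ x n m = begin
  lucasU x q (suc m)                            ≡⟨ lucasU-suc-binomial-half x q m ⟩
  ∑< (suc (m / 2)) (binomialTerm x q m)         ≡⟨ ∑<-cong (suc (m / 2)) (sym ∘ summand) ⟩
  ∑< (suc (m / 2)) (λ i → binom (m ∸ i) i * x ^ (suc m ∸ 2 ℕ.* i ∸ 1) * negOnePow (i ℕ.* (n ℕ.+ 1)))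
                                                ≡⟨ sym (sumFromTo-0 (m / 2) _) ⟩
  sumFromTo 0 (m / 2) (λ i → binom (m ∸ i) i * x ^ (suc m ∸ 2 ℕ.* i ∸ 1) * negOnePow (i ℕ.* (n ℕ.+ 1))) ∎
  where
  q : ℤ
  q = negOnePow (n ℕ.+ 1)

  exponent : ∀ i → suc m ∸ 2 ℕ.* i ∸ 1 ≡ m ∸ i ∸ i
  exponent i = begin
    suc m ∸ 2 ℕ.* i ∸ 1        ≡⟨ ℕₚ.∸-+-assoc (suc m) (2 ℕ.* i) 1 ⟩
    suc m ∸ (2 ℕ.* i ℕ.+ 1)    ≡⟨ cong (suc m ∸_) (twice+1 i) ⟩
    m ∸ (i ℕ.+ i)              ≡⟨ sym (ℕₚ.∸-+-assoc m i i) ⟩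
    m ∸ i ∸ i                  ∎
    where
    twice+1 : ∀ i → 2 ℕ.* i ℕ.+ 1 ≡ suc (i ℕ.+ i)
    twice+1 = ℕ-Solver.solve-∀

  summand : ∀ i → binom (m ∸ i) i * x ^ (suc m ∸ 2 ℕ.* i ∸ 1) * negOnePow (i ℕ.* (n ℕ.+ 1)) ≡ binomialTerm x q m i
  summand i = cong₂ (λ e p → binom (m ∸ i) i * x ^ e * p) (exponent i) (negOnePow-* i (n ℕ.+ 1))

q*lucasU≡sumFromTo₁ : ∀ x n m →
  negOnePow (n ℕ.+ 1) * lucasU x (negOnePow (n ℕ.+ 1)) m
    ≡ sumFromTo 1 (suc m / 2) (λ i → binom (m ∸ i) (i ∸ 1) * x ^ (suc m ∸ 2 ℕ.* i) * negOnePow (i ℕ.* (n ℕ.+ 1)))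
q*lucasU≡sumFromTo₁ x n m = begin
  q * lucasU x q m                                         ≡⟨ cong (q *_) (lucasU-binomial-half x q m) ⟩
  q * ∑< (suc m / 2) (binomialTerm x q (m ∸ 1))            ≡⟨ sym (∑<-*ˡ (suc m / 2) q _) ⟩
  ∑< (suc m / 2) (λ j → q * binomialTerm x q (m ∸ 1) j)    ≡⟨ ∑<-cong (suc m / 2) (sym ∘ summand) ⟩
  ∑< (suc m / 2) (λ j → binom (m ∸ suc j) j * x ^ (suc m ∸ 2 ℕ.* suc j) * negOnePow (suc j ℕ.* (n ℕ.+ 1)))
                                                           ≡⟨ sym (sumFromTo-1 (suc m / 2) _) ⟩
  sumFromTo 1 (suc m / 2) (λ i → binom (m ∸ i) (i ∸ 1) * x ^ (suc m ∸ 2 ℕ.* i) * negOnePow (i ℕ.* (n ℕ.+ 1))) ∎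
  where
  q : ℤ
  q = negOnePow (n ℕ.+ 1)

  exponent : ∀ j → suc m ∸ 2 ℕ.* suc j ≡ m ∸ 1 ∸ j ∸ j
  exponent j = begin
    suc m ∸ 2 ℕ.* suc j        ≡⟨ cong (suc m ∸_) (twice-suc j) ⟩
    m ∸ suc (j ℕ.+ j)          ≡⟨ sym (ℕₚ.∸-+-assoc m 1 (j ℕ.+ j)) ⟩
    m ∸ 1 ∸ (j ℕ.+ j)          ≡⟨ sym (ℕₚ.∸-+-assoc (m ∸ 1) j j) ⟩
    m ∸ 1 ∸ j ∸ j              ∎
    where
    twice-suc : ∀ j → 2 ℕ.* suc j ≡ suc (suc (j ℕ.+ j))
    twice-suc = ℕ-Solver.solve-∀

  summand : ∀ j → binom (m ∸ suc j) j * x ^ (suc m ∸ 2 ℕ.* suc j) * negOnePow (suc j ℕ.* (n ℕ.+ 1))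
                    ≡ q * binomialTerm x q (m ∸ 1) j
  summand j = begin
    binom (m ∸ suc j) j * x ^ (suc m ∸ 2 ℕ.* suc j) * negOnePow (suc j ℕ.* (n ℕ.+ 1))
      ≡⟨ cong₂ (λ d e → binom d j * x ^ e * negOnePow (suc j ℕ.* (n ℕ.+ 1))) (sym (ℕₚ.∸-+-assoc m 1 j)) (exponent j) ⟩
    binom (m ∸ 1 ∸ j) j * x ^ (m ∸ 1 ∸ j ∸ j) * negOnePow (suc j ℕ.* (n ℕ.+ 1))
      ≡⟨ cong (binom (m ∸ 1 ∸ j) j * x ^ (m ∸ 1 ∸ j ∸ j) *_) (negOnePow-* (suc j) (n ℕ.+ 1)) ⟩
    binom (m ∸ 1 ∸ j) j * x ^ (m ∸ 1 ∸ j ∸ j) * (q * q ^ j)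
      ≡⟨ pull-out (binom (m ∸ 1 ∸ j) j) (x ^ (m ∸ 1 ∸ j ∸ j)) q (q ^ j) ⟩
    q * binomialTerm x q (m ∸ 1) j ∎
    where
    pull-out : ∀ c y q e → c * y * (q * e) ≡ q * (c * y * e)
    pull-out = ℤ-Solver.solve-∀

module _ (a b : ℤ) where

  private
    g : ℕ → ℤ
    g = G a b

  -- The case n + 2 is the sum of the cases (n + 1, k + 1) and (n, k + 2).
  G-lucas : ∀ n k → g (n ℕ.+ n ℕ.+ k) + negOnePow n * g k ≡ L n * g (n ℕ.+ k)
  G-lucas zero k = double (g k)
    where
    double : ∀ y → y + + 1 * y ≡ + 2 * y
    double = ℤ-Solver.solve-∀
  G-lucas (suc zero) k = cancel (g (suc k)) (g k)
    where
    cancel : ∀ u v → u + v + (- + 1 * + 1) * v ≡ + 1 * u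
    cancel = ℤ-Solver.solve-∀
  G-lucas (suc (suc n)) k = begin
    g (2 ℕ.+ n ℕ.+ (2 ℕ.+ n) ℕ.+ k) + negOnePow (2 ℕ.+ n) * g k
      ≡⟨ cong₂ (λ i j → g i + g j + negOnePow (2 ℕ.+ n) * g k) (idx₁ n k) (idx₂ n k) ⟩
    g (suc n ℕ.+ suc n ℕ.+ suc k) + g (n ℕ.+ n ℕ.+ (2 ℕ.+ k)) + negOnePow (2 ℕ.+ n) * g k
      ≡⟨ regroup (g (suc n ℕ.+ suc n ℕ.+ suc k)) (g (n ℕ.+ n ℕ.+ (2 ℕ.+ k))) (negOnePow n) (g (suc k)) (g k) ⟩
    (g (suc n ℕ.+ suc n ℕ.+ suc k) + negOnePow (suc n) * g (suc k))
      + (g (n ℕ.+ n ℕ.+ (2 ℕ.+ k)) + negOnePow n * g (2 ℕ.+ k))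
      ≡⟨ cong₂ _+_ (G-lucas (suc n) (suc k)) (G-lucas n (2 ℕ.+ k)) ⟩
    L (suc n) * g (suc n ℕ.+ suc k) + L n * g (n ℕ.+ (2 ℕ.+ k))
      ≡⟨ cong₂ (λ i j → L (suc n) * g i + L n * g j) (idx₃ n k) (idx₄ n k) ⟩
    L (suc n) * g (2 ℕ.+ n ℕ.+ k) + L n * g (2 ℕ.+ n ℕ.+ k)
      ≡⟨ sym (ℤₚ.*-distribʳ-+ (g (2 ℕ.+ n ℕ.+ k)) (L (suc n)) (L n)) ⟩
    L (2 ℕ.+ n) * g (2 ℕ.+ n ℕ.+ k) ∎
    where
    idx₁ : ∀ n k → suc (n ℕ.+ suc (suc n) ℕ.+ k) ≡ suc n ℕ.+ suc n ℕ.+ suc k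
    idx₁ = ℕ-Solver.solve-∀
    idx₂ : ∀ n k → n ℕ.+ suc (suc n) ℕ.+ k ≡ n ℕ.+ n ℕ.+ suc (suc k)
    idx₂ = ℕ-Solver.solve-∀
    idx₃ : ∀ n k → suc n ℕ.+ suc k ≡ suc (suc n) ℕ.+ k
    idx₃ = ℕ-Solver.solve-∀
    idx₄ : ∀ n k → n ℕ.+ suc (suc k) ≡ suc (suc n) ℕ.+ k
    idx₄ = ℕ-Solver.solve-∀
    regroup : ∀ y₁ y₂ e u v →
      y₁ + y₂ + (- + 1 * (- + 1 * e)) * v ≡ (y₁ + (- + 1 * e) * u) + (y₂ + e * (u + v))
    regroup = ℤ-Solver.solve-∀

  G-multiples-recurrent : ∀ n → Recurrent (L n) (negOnePow (n ℕ.+ 1)) (λ m → g (n ℕ.* m))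
  G-multiples-recurrent n m = begin
    g (n ℕ.* (2 ℕ.+ m))
      ≡⟨ cong g (idx n m) ⟩
    g (n ℕ.+ n ℕ.+ n ℕ.* m)
      ≡⟨ move (g (n ℕ.+ n ℕ.+ n ℕ.* m)) (negOnePow n) (g (n ℕ.* m)) ⟩
    (g (n ℕ.+ n ℕ.+ n ℕ.* m) + negOnePow n * g (n ℕ.* m)) + - + 1 * negOnePow n * g (n ℕ.* m)
      ≡⟨ cong₂ _+_ (G-lucas n (n ℕ.* m)) (cong (λ e → e * g (n ℕ.* m)) (sym (cong negOnePow (ℕₚ.+-comm n 1)))) ⟩
    L n * g (n ℕ.+ n ℕ.* m) + negOnePow (n ℕ.+ 1) * g (n ℕ.* m)
      ≡⟨ cong (λ i → L n * g i + negOnePow (n ℕ.+ 1) * g (n ℕ.* m)) (sym (ℕₚ.*-suc n m)) ⟩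
    L n * g (n ℕ.* suc m) + negOnePow (n ℕ.+ 1) * g (n ℕ.* m) ∎
    where
    idx : ∀ n m → n ℕ.* (2 ℕ.+ m) ≡ n ℕ.+ n ℕ.+ n ℕ.* m
    idx = ℕ-Solver.solve-∀
    move : ∀ y e z → y ≡ (y + e * z) + - + 1 * e * z
    move = ℤ-Solver.solve-∀

  G-multiples≡lucasU : ∀ n m →
    g (n ℕ.* suc m) ≡ g n * lucasU (L n) (negOnePow (n ℕ.+ 1)) (suc m)
                      + g 0 * (negOnePow (n ℕ.+ 1) * lucasU (L n) (negOnePow (n ℕ.+ 1)) m)
  G-multiples≡lucasU n m =
    trans (recurrent⇒lucasU-combination (λ m → g (n ℕ.* m)) (G-multiples-recurrent n) m)
          (cong₂ (λ i j → g i * lucasU (L n) q (suc m) + g j * (q * lucasU (L n) q m))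
                 (ℕₚ.*-identityʳ n) (ℕₚ.*-zeroʳ n))
    where
    q : ℤ
    q = negOnePow (n ℕ.+ 1)

mainTheorem3 : (a b : ℤ) (n m : ℕ) → n > 0 → m > 0 →
    G a b (n ℕ.* m) ≡
      G a b n * sumFromTo 0 ((m ∸ 1) / 2)
                 (λ i → binom (m ∸ 1 ∸ i) i * (L n ^ (m ∸ 2 ℕ.* i ∸ 1)) * negOnePow (i ℕ.* (n ℕ.+ 1)))
      + G a b 0 * sumFromTo 1 (m / 2)
                 (λ i → binom (m ∸ 1 ∸ i) (i ∸ 1) * (L n ^ (m ∸ 2 ℕ.* i)) * negOnePow (i ℕ.* (n ℕ.+ 1)))
mainTheorem3 a b n (suc m) _ _ =
  trans (G-multiples≡lucasU a b n m)
        (cong₂ (λ u v → G a b n * u + G a b 0 * v) (lucasU≡sumFromTo₀ (L n) n m) (q*lucasU≡sumFromTo₁ (L n) n m))
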